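{- Let $n,b,c,t$ be positive integers with $n\ge b+c+3$, $b\ge t+1$ and $c\ge t$. For $x\in\{t,\dots,b\}$ let $$h_{b,c}(x)=q^{x-t}{x\brack t}{c-t+1\brack 1}^{x-t}{n-x\brack b-x}.$$ Then $h_{b,c}(x)$ is decreasing in $x$ on $\{t,\dots,b\}$.
   Context: $q$ is a prime power. The Gaussian binomial coefficient is ${m\brack i}=\prod_{0\le j<i}\frac{q^{m-j}-1}{q^{i-j}-1}$, with ${m\brack 0}=1$. -}

module Defs where

open import Data.Nat using (ℕ; zero; suc; _+_; _*_; _∸_; _^_; _≤_; _<_; NonZero; _/_; s≤s; z≤n)
open import Data.Nat.Properties using (m*n≢0; m^n≢0; *-comm; ≤-trans; m≤m*n)
open import Data.Nat.Primality using (Prime)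
open import Data.Product using (Σ; _×_; _,_)
open import Relation.Binary.PropositionalEquality using (_≡_; refl)

IsPrimePower : ℕ → Set
IsPrimePower q = Σ ℕ λ p → Σ ℕ λ e → Prime p × 1 ≤ e × q ≡ p ^ e

prodBelow : ℕ → (ℕ → ℕ) → ℕ
prodBelow zero    f = 1
prodBelow (suc i) f = prodBelow i f * f i

-- numerator ∏_{0≤j<i} (q^{m-j} - 1)  (natural subtraction; if i > m some
-- factor is q^0 - 1 = 0, so the value is 0, as it should be)
gaussNum : ℕ → ℕ → ℕ → ℕ
gaussNum q m i = prodBelow i (λ j → q ^ (m ∸ j) ∸ 1)

gaussDen : ℕ → ℕ → ℕ
gaussDen q i = prodBelow i (λ j → q ^ (i ∸ j) ∸ 1)

private
  pow-nz : ∀ r k → NonZero (suc (suc r) ^ suc k ∸ 1)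
  pow-nz r k with suc (suc r) ^ k | m^n≢0 (suc (suc r)) k
  ... | suc a | _ = Data.Nat.>-nonZero
        (≤-trans (s≤s z≤n) (Data.Nat.Properties.m≤n+m (suc (a + r * suc a)) a))

  fac-nz : ∀ r i j → j < i → NonZero (suc (suc r) ^ (i ∸ j) ∸ 1)
  fac-nz r (suc i) zero    _         = pow-nz r i
  fac-nz r (suc i) (suc j) (s≤s j<i) = fac-nz r i j j<i

  prod-nz : ∀ r i n → n ≤ i → NonZero (prodBelow n (λ j → suc (suc r) ^ (i ∸ j) ∸ 1))
  prod-nz r i zero    _  = _
  prod-nz r i (suc n) le =
    m*n≢0 _ _ {{prod-nz r i n (≤-trans (Data.Nat.Properties.n≤1+n n) le)}}
              {{fac-nz r i n le}}

gaussDen-nz : ∀ q → 2 ≤ q → ∀ i → NonZero (gaussDen q i)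
gaussDen-nz (suc (suc r)) _ i = prod-nz r i i Data.Nat.Properties.≤-refl
gaussDen-nz (suc zero) (s≤s ()) i

-- The Gaussian binomial [m brack i] = ∏_{0≤j<i} (q^{m-j}-1)/(q^{i-j}-1),
-- computed as (product of numerators) / (product of denominators); this
-- quotient is exact since the Gaussian binomial coefficient is an integer.
gauss : (q : ℕ) → 2 ≤ q → ℕ → ℕ → ℕ
gauss q h m i = _/_ (gaussNum q m i) (gaussDen q i) {{gaussDen-nz q h i}}

hbc : (q : ℕ) → 2 ≤ q → (n b c t x : ℕ) → ℕ
hbc q h n b c t x =
  q ^ (x ∸ t) * gauss q h x t * gauss q h (c ∸ t + 1) 1 ^ (x ∸ t)
    * gauss q h (n ∸ x) (b ∸ x)

primePower⇒2≤ : ∀ {q} → IsPrimePower q → 2 ≤ q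
primePower⇒2≤ (p , suc e , pr , _ , refl) =
  ≤-trans (Data.Nat.nonTrivial⇒n>1 p {{Data.Nat.Primality.prime⇒nonTrivial pr}})
          (m≤m*n p (p ^ e) {{m^n≢0 p e {{Data.Nat.Primality.prime⇒nonZero pr}}}})

-- Write [k] = q^k - 1. Defining ⁅m, i⁆ by the q-Pascal rule and checking
-- gaussNum = ⁅m, i⁆ · gaussDen shows that the quotient in gauss is exact, and gives the
-- absorption identities ⁅m+1, i+1⁆ [i+1] = [m+1] ⁅m, i⁆ and ⁅m+1, t⁆ [m+1-t] = [m+1] ⁅m, t⁆.
-- With e = x - t, s = c - t + 1 and ⁅s, 1⁆ = [s]/[1] they turn the ratio of consecutive
-- values into
--   h(x+1) / h(x) = q [x+1] [s] [b-x] / ([e+1] [1] [n-x]),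
-- which is < 1 for every q ≥ 2: [x+1] [1] ≤ [e+1] [t+1], while
-- q [t+1] [s] [b-x] ≤ q [t+s+b-x+1] < [t+s+b-x+2] ≤ [n-x] because b + c + 3 ≤ n.
module Submission where

open import Defs
open import Data.Nat
open import Data.Nat.Properties
open import Data.Nat.DivMod using (m*n/n≡m)
open import Data.Nat.Tactic.RingSolver using (solve-∀)
open import Relation.Binary.PropositionalEquality
open import Relation.Nullary using (yes; no)
open import Algebra.Properties.CommutativeSemigroup *-commutativeSemigroup using (xy∙z≈xz∙y)

prodBelow-suc : ∀ i (f : ℕ → ℕ) → prodBelow (suc i) f ≡ f 0 * prodBelow i (λ j → f (suc j))
prodBelow-suc zero    f = *-comm 1 (f 0)
prodBelow-suc (suc i) f = begin
    prodBelow i f * f i * f (suc i)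
  ≡⟨ cong (_* f (suc i)) (prodBelow-suc i f) ⟩
    f 0 * prodBelow i (λ j → f (suc j)) * f (suc i)
  ≡⟨ *-assoc (f 0) _ _ ⟩
    f 0 * (prodBelow i (λ j → f (suc j)) * f (suc i)) ∎
  where open ≡-Reasoning

[u∸1]+u*[v∸1]≡u*v∸1 : ∀ {u v} → 1 ≤ u → 1 ≤ v → (u ∸ 1) + u * (v ∸ 1) ≡ u * v ∸ 1
[u∸1]+u*[v∸1]≡u*v∸1 {suc u} {suc v} _ _ = identity u v
  where
  identity : ∀ u v → u + suc u * v ≡ v + u * suc v
  identity = solve-∀

[u∸1]*[v∸1]≤u*v∸1 : ∀ {u v} → 1 ≤ u → 1 ≤ v → (u ∸ 1) * (v ∸ 1) ≤ u * v ∸ 1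
[u∸1]*[v∸1]≤u*v∸1 {suc u} {suc v} _ _ =
  ≤-trans (*-monoʳ-≤ u (n≤1+n v)) (m≤n+m (u * suc v) v)

[p*u*v∸1]*[p∸1]≤[p*u∸1]*[p*v∸1] : ∀ {p u v} → 1 ≤ p → 1 ≤ u → 1 ≤ v →
                                   (p * (u * v) ∸ 1) * (p ∸ 1) ≤ (p * u ∸ 1) * (p * v ∸ 1)
[p*u*v∸1]*[p∸1]≤[p*u∸1]*[p*v∸1] {suc a} {suc b} {suc c} _ _ _ =
  ≤-trans (m≤m+n _ (suc a * b * c)) (≤-reflexive (identity a b c))
  where
  -- (puv-1)(p-1) + p(u-1)(v-1) = (pu-1)(pv-1), with every ∸ 1 already evaluated
  identity : ∀ a b c → (c + b * suc c + a * suc (c + b * suc c)) * a + suc a * b * c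
                       ≡ (b + a * suc b) * (c + a * suc c)
  identity = solve-∀

m∸n≡suc[m∸suc[n]] : ∀ {m n} → n < m → m ∸ n ≡ suc (m ∸ suc n)
m∸n≡suc[m∸suc[n]] = +-∸-assoc 1

b+c+3≤n⇒b≤n : ∀ {b c n} → b + c + 3 ≤ n → b ≤ n
b+c+3≤n⇒b≤n {b} {c} = ≤-trans (m≤n⇒m≤n+o 3 (m≤m+n b c))

2+t+[c∸t+1]+[b∸x]≤n∸x : ∀ {n b c t x} → x ≤ b → t ≤ c → b + c + 3 ≤ n →
                         2 + t + (c ∸ t + 1) + (b ∸ x) ≤ n ∸ x
2+t+[c∸t+1]+[b∸x]≤n∸x {n} {b} {c} {t} {x} x≤b t≤c b+c+3≤n = +-cancelʳ-≤ x _ _ (begin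
    2 + t + (c ∸ t + 1) + (b ∸ x) + x
  ≡⟨ regroup t (c ∸ t) (b ∸ x) x ⟩
    (b ∸ x + x) + (c ∸ t + t) + 3
  ≡⟨ cong₂ (λ u v → u + v + 3) (m∸n+n≡m x≤b) (m∸n+n≡m t≤c) ⟩
    b + c + 3
  ≤⟨ b+c+3≤n ⟩
    n
  ≡⟨ sym (m∸n+n≡m x≤n) ⟩
    n ∸ x + x ∎)
  where
  open ≤-Reasoning
  x≤n : x ≤ n
  x≤n = ≤-trans x≤b (b+c+3≤n⇒b≤n b+c+3≤n)
  regroup : ∀ t c′ b′ x → 2 + t + (c′ + 1) + b′ + x ≡ (b′ + x) + (c′ + t) + 3
  regroup = solve-∀

module GaussianBinomial (q : ℕ) (2≤q : 2 ≤ q) where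

  Q : ℕ → ℕ
  Q k = q ^ k ∸ 1

  qBinom : ℕ → ℕ → ℕ
  qBinom m       zero    = 1
  qBinom zero    (suc i) = 0
  qBinom (suc m) (suc i) = qBinom m i + q ^ suc i * qBinom m (suc i)

  instance
    q≢0 : NonZero q
    q≢0 = >-nonZero (≤-trans (s≤s z≤n) 2≤q)

  q^k≢0 : ∀ {k} → NonZero (q ^ k)
  q^k≢0 {k} = m^n≢0 q k

  q^k≥1 : ∀ k → 1 ≤ q ^ k
  q^k≥1 k = m^n>0 q k

  Q-suc>0 : ∀ k → 0 < Q (suc k)
  Q-suc>0 k = ∸-monoˡ-≤ 1 (*-mono-≤ 2≤q (q^k≥1 k))

  Q-mono-≤ : ∀ {a b} → a ≤ b → Q a ≤ Q b
  Q-mono-≤ a≤b = ∸-monoˡ-≤ 1 (^-monoʳ-≤ q a≤b)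

  Q-+ : ∀ {i m} → i ≤ m → Q (suc i) + q ^ suc i * Q (m ∸ i) ≡ Q (suc m)
  Q-+ {i} {m} i≤m = begin
      Q (suc i) + q ^ suc i * Q (m ∸ i)
    ≡⟨ [u∸1]+u*[v∸1]≡u*v∸1 (q^k≥1 (suc i)) (q^k≥1 (m ∸ i)) ⟩
      q ^ suc i * q ^ (m ∸ i) ∸ 1
    ≡⟨ cong (_∸ 1) (sym (^-distribˡ-+-* q (suc i) (m ∸ i))) ⟩
      q ^ suc (i + (m ∸ i)) ∸ 1
    ≡⟨ cong (λ k → Q (suc k)) (m+[n∸m]≡n i≤m) ⟩
      Q (suc m) ∎
    where open ≡-Reasoning

  N : ℕ → ℕ → ℕ
  N = gaussNum q

  D : ℕ → ℕ
  D = gaussDen q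

  D≢0 : ∀ i → NonZero (D i)
  D≢0 = gaussDen-nz q 2≤q

  gaussNum-suc : ∀ m i → N (suc m) (suc i) ≡ Q (suc m) * N m i
  gaussNum-suc m i = prodBelow-suc i (λ j → Q (suc m ∸ j))

  gaussDen-suc : ∀ i → D (suc i) ≡ Q (suc i) * D i
  gaussDen-suc i = prodBelow-suc i (λ j → Q (suc i ∸ j))

  gaussNum-vanish : ∀ {m i} → m < i → N m i ≡ 0
  gaussNum-vanish {m} {suc i} (s≤s m≤i) rewrite m≤n⇒m∸n≡0 m≤i = *-zeroʳ (N m i)

  gaussNum-pascal : ∀ m i → Q (suc m) * N m i ≡ Q (suc i) * N m i + q ^ suc i * N m (suc i)
  gaussNum-pascal m i with i ≤? m
  ... | yes i≤m = begin
      Q (suc m) * N m i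
    ≡⟨ cong (_* N m i) (sym (Q-+ i≤m)) ⟩
      (Q (suc i) + q ^ suc i * Q (m ∸ i)) * N m i
    ≡⟨ regroup (Q (suc i)) (q ^ suc i) (Q (m ∸ i)) (N m i) ⟩
      Q (suc i) * N m i + q ^ suc i * (N m i * Q (m ∸ i)) ∎
    where
    open ≡-Reasoning
    regroup : ∀ a b c n → (a + b * c) * n ≡ a * n + b * (n * c)
    regroup = solve-∀
  ... | no i≰m
    rewrite gaussNum-vanish (≰⇒> i≰m) =
    trans (*-zeroʳ (Q (suc m))) (sym (cong₂ _+_ (*-zeroʳ (Q (suc i))) (*-zeroʳ (q ^ suc i))))

  gaussNum≡qBinom*gaussDen : ∀ m i → N m i ≡ qBinom m i * D i
  gaussNum≡qBinom*gaussDen m       zero    = refl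
  gaussNum≡qBinom*gaussDen zero    (suc i) = gaussNum-vanish {0} {suc i} (s≤s z≤n)
  gaussNum≡qBinom*gaussDen (suc m) (suc i) = begin
      N (suc m) (suc i)
    ≡⟨ gaussNum-suc m i ⟩
      Q (suc m) * N m i
    ≡⟨ gaussNum-pascal m i ⟩
      Q (suc i) * N m i + q ^ suc i * N m (suc i)
    ≡⟨ cong₂ (λ a b → Q (suc i) * a + q ^ suc i * b)
             (gaussNum≡qBinom*gaussDen m i) (gaussNum≡qBinom*gaussDen m (suc i)) ⟩
      Q (suc i) * (qBinom m i * D i) + q ^ suc i * (qBinom m (suc i) * D (suc i))
    ≡⟨ cong (λ d → Q (suc i) * (qBinom m i * D i) + q ^ suc i * (qBinom m (suc i) * d))
            (gaussDen-suc i) ⟩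
      Q (suc i) * (qBinom m i * D i) + q ^ suc i * (qBinom m (suc i) * (Q (suc i) * D i))
    ≡⟨ regroup (qBinom m i) (qBinom m (suc i)) (q ^ suc i) (Q (suc i)) (D i) ⟩
      qBinom (suc m) (suc i) * (Q (suc i) * D i)
    ≡⟨ cong (qBinom (suc m) (suc i) *_) (sym (gaussDen-suc i)) ⟩
      qBinom (suc m) (suc i) * D (suc i) ∎
    where
    open ≡-Reasoning
    regroup : ∀ a b c d e → d * (a * e) + c * (b * (d * e)) ≡ (a + c * b) * (d * e)
    regroup = solve-∀

  gauss≡qBinom : ∀ m i → gauss q 2≤q m i ≡ qBinom m i
  gauss≡qBinom m i = trans (cong (λ a → _/_ a (D i) {{D≢0 i}}) (gaussNum≡qBinom*gaussDen m i))
                           (m*n/n≡m (qBinom m i) (D i) {{D≢0 i}})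

  qBinom>0 : ∀ {m i} → i ≤ m → 0 < qBinom m i
  qBinom>0 {m}     {zero}  _         = s≤s z≤n
  qBinom>0 {suc m} {suc i} (s≤s i≤m) = ≤-trans (qBinom>0 i≤m) (m≤m+n _ _)

  qBinom-absorbˡ : ∀ m i → qBinom (suc m) (suc i) * Q (suc i) ≡ Q (suc m) * qBinom m i
  qBinom-absorbˡ m i = *-cancelʳ-≡ _ _ (D i) {{D≢0 i}} (begin
      qBinom (suc m) (suc i) * Q (suc i) * D i
    ≡⟨ *-assoc (qBinom (suc m) (suc i)) _ _ ⟩
      qBinom (suc m) (suc i) * (Q (suc i) * D i)
    ≡⟨ cong (qBinom (suc m) (suc i) *_) (sym (gaussDen-suc i)) ⟩
      qBinom (suc m) (suc i) * D (suc i)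
    ≡⟨ sym (gaussNum≡qBinom*gaussDen (suc m) (suc i)) ⟩
      N (suc m) (suc i)
    ≡⟨ gaussNum-suc m i ⟩
      Q (suc m) * N m i
    ≡⟨ cong (Q (suc m) *_) (gaussNum≡qBinom*gaussDen m i) ⟩
      Q (suc m) * (qBinom m i * D i)
    ≡⟨ sym (*-assoc (Q (suc m)) _ _) ⟩
      Q (suc m) * qBinom m i * D i ∎)
    where open ≡-Reasoning

  qBinom-absorbʳ : ∀ m i → qBinom (suc m) i * Q (suc m ∸ i) ≡ Q (suc m) * qBinom m i
  qBinom-absorbʳ m zero    = *-comm 1 (Q (suc m))
  qBinom-absorbʳ m (suc i) = *-cancelʳ-≡ _ _ (D (suc i)) {{D≢0 (suc i)}} (begin
      qBinom (suc m) (suc i) * Q (m ∸ i) * D (suc i)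
    ≡⟨ xy∙z≈xz∙y (qBinom (suc m) (suc i)) _ _ ⟩
      qBinom (suc m) (suc i) * D (suc i) * Q (m ∸ i)
    ≡⟨ cong (_* Q (m ∸ i)) (sym (gaussNum≡qBinom*gaussDen (suc m) (suc i))) ⟩
      N (suc m) (suc i) * Q (m ∸ i)
    ≡⟨ cong (_* Q (m ∸ i)) (gaussNum-suc m i) ⟩
      Q (suc m) * N m i * Q (m ∸ i)
    ≡⟨ *-assoc (Q (suc m)) _ _ ⟩
      Q (suc m) * N m (suc i)
    ≡⟨ cong (Q (suc m) *_) (gaussNum≡qBinom*gaussDen m (suc i)) ⟩
      Q (suc m) * (qBinom m (suc i) * D (suc i))
    ≡⟨ sym (*-assoc (Q (suc m)) _ _) ⟩
      Q (suc m) * qBinom m (suc i) * D (suc i) ∎)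
    where open ≡-Reasoning

  qBinom-1 : ∀ m → qBinom m 1 * Q 1 ≡ Q m
  qBinom-1 zero    = refl
  qBinom-1 (suc m) = trans (qBinom-absorbˡ m 0) (*-identityʳ (Q (suc m)))

  Q-*-≤ : ∀ a b → Q a * Q b ≤ Q (a + b)
  Q-*-≤ a b rewrite ^-distribˡ-+-* q a b = [u∸1]*[v∸1]≤u*v∸1 (q^k≥1 a) (q^k≥1 b)

  q*Q<Q-suc : ∀ a → q * Q a < Q (suc a)
  q*Q<Q-suc a rewrite *-distribˡ-∸ q (q ^ a) 1 | *-identityʳ q =
    ∸-monoʳ-< 2≤q (m≤m*n q (q ^ a) {{q^k≢0 {a}}})

  Q[1+e+t]*Q1≤Q[1+e]*Q[1+t] : ∀ e t → Q (suc e + t) * Q 1 ≤ Q (suc e) * Q (suc t)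
  Q[1+e+t]*Q1≤Q[1+e]*Q[1+t] e t
    rewrite ^-distribˡ-+-* q e t | *-identityʳ q =
    [p*u*v∸1]*[p∸1]≤[p*u∸1]*[p*v∸1] (≤-trans (s≤s z≤n) 2≤q) (q^k≥1 e) (q^k≥1 t)

  q*Q[1+t]*Qs*Qr<QL : ∀ t s r L → 2 + t + s + r ≤ L → q * Q (suc t) * Q s * Q r < Q L
  q*Q[1+t]*Qs*Qr<QL t s r L bound = begin-strict
      q * Q (suc t) * Q s * Q r
    ≡⟨ *-assoc (q * Q (suc t)) (Q s) (Q r) ⟩
      q * Q (suc t) * (Q s * Q r)
    ≡⟨ *-assoc q (Q (suc t)) (Q s * Q r) ⟩
      q * (Q (suc t) * (Q s * Q r))
    ≤⟨ *-monoʳ-≤ q (*-monoʳ-≤ (Q (suc t)) (Q-*-≤ s r)) ⟩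
      q * (Q (suc t) * Q (s + r))
    ≤⟨ *-monoʳ-≤ q (Q-*-≤ (suc t) (s + r)) ⟩
      q * Q (suc t + (s + r))
    <⟨ q*Q<Q-suc (suc t + (s + r)) ⟩
      Q (2 + (t + (s + r)))
    ≡⟨ cong (λ k → Q (2 + k)) (sym (+-assoc t s r)) ⟩
      Q (2 + t + s + r)
    ≤⟨ Q-mono-≤ bound ⟩
      Q L ∎
    where open ≤-Reasoning

  ratio<1 : ∀ e t s r L → 2 + t + s + r ≤ L →
            q * Q (suc e + t) * Q s * Q r < Q (suc e) * Q 1 * Q L
  ratio<1 e t s r L bound = *-cancelˡ-< (Q 1) _ _ (begin-strict
      Q 1 * (q * Q (suc e + t) * Q s * Q r)
    ≡⟨ regroup₁ (Q 1) q (Q (suc e + t)) (Q s) (Q r) ⟩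
      q * (Q (suc e + t) * Q 1) * Q s * Q r
    ≤⟨ *-monoˡ-≤ (Q r) (*-monoˡ-≤ (Q s) (*-monoʳ-≤ q (Q[1+e+t]*Q1≤Q[1+e]*Q[1+t] e t))) ⟩
      q * (Q (suc e) * Q (suc t)) * Q s * Q r
    ≡⟨ regroup₂ q (Q (suc e)) (Q (suc t)) (Q s) (Q r) ⟩
      Q (suc e) * (q * Q (suc t) * Q s * Q r)
    <⟨ *-monoʳ-< (Q (suc e)) {{>-nonZero (Q-suc>0 e)}} (q*Q[1+t]*Qs*Qr<QL t s r L bound) ⟩
      Q (suc e) * Q L
    ≤⟨ m≤n*m (Q (suc e) * Q L) (Q 1 * Q 1) {{>-nonZero (*-mono-≤ (Q-suc>0 0) (Q-suc>0 0))}} ⟩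
      Q 1 * Q 1 * (Q (suc e) * Q L)
    ≡⟨ regroup₃ (Q 1) (Q (suc e)) (Q L) ⟩
      Q 1 * (Q (suc e) * Q 1 * Q L) ∎)
    where
    open ≤-Reasoning
    regroup₁ : ∀ a b c d e → a * (b * c * d * e) ≡ b * (c * a) * d * e
    regroup₁ = solve-∀
    regroup₂ : ∀ a b c d e → a * (b * c) * d * e ≡ b * (a * c * d * e)
    regroup₂ = solve-∀
    regroup₃ : ∀ a b c → a * a * (b * c) ≡ a * (b * a * c)
    regroup₃ = solve-∀

  hbc≡ : ∀ n b c t x → hbc q 2≤q n b c t x ≡
         q ^ (x ∸ t) * qBinom x t * qBinom (c ∸ t + 1) 1 ^ (x ∸ t) * qBinom (n ∸ x) (b ∸ x)
  hbc≡ n b c t x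
    rewrite gauss≡qBinom x t | gauss≡qBinom (c ∸ t + 1) 1 | gauss≡qBinom (n ∸ x) (b ∸ x) = refl

  hbc-step : ∀ {x t s k M} → t ≤ x → 0 < s → 2 + t + s + suc k ≤ suc M →
    q ^ suc (x ∸ t) * qBinom (suc x) t * qBinom s 1 ^ suc (x ∸ t) * qBinom M k
    < q ^ (x ∸ t) * qBinom x t * qBinom s 1 ^ (x ∸ t) * qBinom (suc M) (suc k)
  hbc-step {x} {t} {s} {k} {M} t≤x s>0 bound = *-cancelʳ-< W _ _ (begin-strict
      q ^ suc e * X′ * B ^ suc e * Y′ * W
    ≡⟨ regroup₁ q (q ^ e) X′ B (B ^ e) Y′ (Q (suc e)) (Q 1) (Q (suc M)) ⟩
      q ^ e * B ^ e * q * (X′ * Q (suc e)) * (B * Q 1) * (Y′ * Q (suc M))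
    ≡⟨ cong (λ u → q ^ e * B ^ e * q * u * (B * Q 1) * (Y′ * Q (suc M))) absorbX ⟩
      q ^ e * B ^ e * q * (Q (suc x) * X) * (B * Q 1) * (Y′ * Q (suc M))
    ≡⟨ cong (λ u → q ^ e * B ^ e * q * (Q (suc x) * X) * u * (Y′ * Q (suc M))) (qBinom-1 s) ⟩
      q ^ e * B ^ e * q * (Q (suc x) * X) * Q s * (Y′ * Q (suc M))
    ≡⟨ cong (λ u → q ^ e * B ^ e * q * (Q (suc x) * X) * Q s * u) absorbY ⟩
      q ^ e * B ^ e * q * (Q (suc x) * X) * Q s * (Y * Q (suc k))
    ≡⟨ regroup₂ (q ^ e) (B ^ e) q (Q (suc x)) X (Q s) Y (Q (suc k)) ⟩
      K * (q * Q (suc x) * Q s * Q (suc k))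
    <⟨ *-monoʳ-< K {{>-nonZero K>0}} ratio ⟩
      K * W ∎)
    where
    open ≤-Reasoning
    e = x ∸ t
    B = qBinom s 1
    X = qBinom x t
    X′ = qBinom (suc x) t
    Y = qBinom (suc M) (suc k)
    Y′ = qBinom M k
    K = q ^ e * X * B ^ e * Y
    W = Q (suc e) * Q 1 * Q (suc M)

    absorbX : X′ * Q (suc e) ≡ Q (suc x) * X
    absorbX = trans (cong (λ i → X′ * Q i) (sym (+-∸-assoc 1 t≤x))) (qBinom-absorbʳ x t)
    absorbY : Y′ * Q (suc M) ≡ Y * Q (suc k)
    absorbY = trans (*-comm Y′ (Q (suc M))) (sym (qBinom-absorbˡ M k))
    ratio : q * Q (suc x) * Q s * Q (suc k) < W
    ratio = subst (λ y → q * Q (suc y) * Q s * Q (suc k) < W) (m∸n+n≡m t≤x)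
                  (ratio<1 e t s (suc k) (suc M) bound)

    K>0 : 0 < K
    K>0 = *-mono-≤ (*-mono-≤ (*-mono-≤ (q^k≥1 e) (qBinom>0 t≤x))
                             (m^n>0 B {{>-nonZero (qBinom>0 s>0)}} e))
                   (qBinom>0 (≤-trans (m≤n+m (suc k) (2 + t + s)) bound))

    regroup₁ : ∀ q p x b bₑ y u v w →
               q * p * x * (b * bₑ) * y * (u * v * w) ≡ p * bₑ * q * (x * u) * (b * v) * (y * w)
    regroup₁ = solve-∀
    regroup₂ : ∀ p bₑ q a x c y d →
               p * bₑ * q * (a * x) * c * (y * d) ≡ p * x * bₑ * y * (q * a * c * d)
    regroup₂ = solve-∀

  hbc-decreasing : ∀ {n b c t x} → b + c + 3 ≤ n → t ≤ c → t ≤ x → x < b →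
                   hbc q 2≤q n b c t (suc x) < hbc q 2≤q n b c t x
  hbc-decreasing {n} {b} {c} {t} {x} b+c+3≤n t≤c t≤x x<b
    rewrite hbc≡ n b c t (suc x) | hbc≡ n b c t x
          | +-∸-assoc 1 t≤x
          | m∸n≡suc[m∸suc[n]] x<b
          | m∸n≡suc[m∸suc[n]] (<-≤-trans x<b (b+c+3≤n⇒b≤n b+c+3≤n))
    = hbc-step t≤x (m≤n+m 1 (c ∸ t))
        (subst₂ (λ r L → 2 + t + (c ∸ t + 1) + r ≤ L)
                (m∸n≡suc[m∸suc[n]] x<b)
                (m∸n≡suc[m∸suc[n]] (<-≤-trans x<b (b+c+3≤n⇒b≤n b+c+3≤n)))
                (2+t+[c∸t+1]+[b∸x]≤n∸x (<⇒≤ x<b) t≤c b+c+3≤n))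

lemma3p1 : (q : ℕ) → (pp : IsPrimePower q) → (n b c t : ℕ) →
           1 ≤ n → 1 ≤ b → 1 ≤ c → 1 ≤ t →
           b + c + 3 ≤ n → t + 1 ≤ b → t ≤ c →
           (x : ℕ) → t ≤ x → x < b →
           hbc q (primePower⇒2≤ pp) n b c t (suc x) < hbc q (primePower⇒2≤ pp) n b c t x
lemma3p1 q pp n b c t _ _ _ _ b+c+3≤n _ t≤c x t≤x x<b =
  GaussianBinomial.hbc-decreasing q (primePower⇒2≤ pp) b+c+3≤n t≤c t≤x x<b
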